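{- Let $\Gamma$ be a graph with vertex set $\mathcal{P}$ satisfying conditions (A1), (A2), (A3), (A4) below, and let $n:=\operatorname{diam}\Gamma$. Suppose that $a,b\in\mathcal{P}$ are distinct points such that there exists $p\in\mathcal{P}\setminus\{a,b\}$ with the property that for all $x\in\mathcal{P}$: $$d(x,p)=n \;\Rightarrow\; d(x,a)=n \ \vee\ d(x,b)=n.$$ Then $a$ and $b$ are adjacent. The conditions are: (A1) $\Gamma$ is connected and $\operatorname{diam}\Gamma$ is finite. (A2) For any $x,y\in\mathcal{P}$ there is $z\in\mathcal{P}$ with $d(x,z)=d(x,y)+d(y,z)=\operatorname{diam}\Gamma$. (A3) For any $x,y,z\in\mathcal{P}$ with $d(x,z)=d(y,z)=1$ and $d(x,y)=2$ there is $w\in\mathcal{P}$ with $d(x,w)=d(y,w)=1$ and $d(z,w)=2$. (A4) For any $x,y,z\in\mathcal{P}$ with $x\neq y$ and $d(x,z)=d(y,z)=\operatorname{diam}\Gamma$ there is $w\in\mathcal{P}$ with $d(z,w)=1$, $d(x,w)=\operatorname{diam}\Gamma-1$, and $d(y,w)=\operatorname{diam}\Gamma$.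
   Context: All graphs are undirected, without loops, with at least one vertex (possibly infinitely many). Vertices are called points; $\mathcal{P}$ denotes the vertex set. $d(x,y)$ is the graph-theoretic distance; $x,y$ are adjacent iff $d(x,y)=1$. $\operatorname{diam}\Gamma$ is the supremum of distances between points. -}

module Defs where

open import Level using (Level; _⊔_)
open import Data.Nat using (ℕ; zero; suc; _+_; _∸_; _≤_)
open import Data.Product using (Σ; ∃; ∃-syntax; _×_; _,_)
open import Data.Empty using (⊥)
open import Relation.Nullary using (¬_)
open import Relation.Binary.PropositionalEquality using (_≡_)

record Graph (a ℓ : Level) : Set (Level.suc (a ⊔ ℓ)) where
  field
    Point    : Set a
    Adj      : Point → Point → Set ℓ
    Adj-sym  : ∀ {x y} → Adj x y → Adj y x
    Adj-irr  : ∀ {x} → ¬ Adj x x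

module _ {a ℓ : Level} (Γ : Graph a ℓ) where
  open Graph Γ

  data Walk : Point → Point → ℕ → Set (a ⊔ ℓ) where
    nil  : ∀ {x} → Walk x x zero
    cons : ∀ {x y z k} → Adj x y → Walk y z k → Walk x z (suc k)

  Dist : Point → Point → ℕ → Set (a ⊔ ℓ)
  Dist x y k = Walk x y k × (∀ m → Walk x y m → k ≤ m)

  Connected : Set (a ⊔ ℓ)
  Connected = ∀ x y → ∃[ k ] Walk x y k

  IsDiam : ℕ → Set (a ⊔ ℓ)
  IsDiam n = (∀ x y k → Dist x y k → k ≤ n) × (∃[ x ] ∃[ y ] Dist x y n)

  A1 : ℕ → Set (a ⊔ ℓ)
  A1 n = Connected × IsDiam n

  A2 : ℕ → Set (a ⊔ ℓ)
  A2 n = ∀ x y → ∃[ z ] (Dist x z n ×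
           (∃[ k₁ ] ∃[ k₂ ] (Dist x y k₁ × Dist y z k₂ × k₁ + k₂ ≡ n)))

  A3 : Set (a ⊔ ℓ)
  A3 = ∀ x y z → Dist x z 1 → Dist y z 1 → Dist x y 2 →
         ∃[ w ] (Dist x w 1 × Dist y w 1 × Dist z w 2)

  A4 : ℕ → Set (a ⊔ ℓ)
  A4 n = ∀ x y z → ¬ (x ≡ y) → Dist x z n → Dist y z n →
           ∃[ w ] (Dist z w 1 × Dist x w (n ∸ 1) × Dist y w n)

module Submission where

-- The proof has two steps.
-- (1) Such a p is adjacent to a (and, symmetrically, to b).  Take z with
--     d(p,z) = n and d(p,a) + d(a,z) = n (A2).  As d(p,a) > 0, d(z,a) < n, so
--     d(z,b) = n.  Axiom (A4) for b, p, z yields a neighbour w of z with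
--     d(b,w) = n - 1 and d(p,w) = n; hence d(w,a) = n, and then
--     n ≤ d(w,z) + d(z,a) = 1 + d(a,z) forces d(p,a) = 1.
-- (2) Having the common neighbour p, a ≠ b are at distance 1 or 2.  If the
--     distance were 2, (A3) gives a common neighbour w of a, b with
--     d(p,w) = 2, and (A2) extends p, w to z with d(p,z) = n = 2 + d(w,z);
--     but then d(z,a), d(z,b) ≤ 1 + d(w,z) < n, contradicting the hypothesis.

open import Defs
open import Level using (Level)
open import Function using (id)
open import Data.Nat using (ℕ; zero; suc; _+_; _∸_; _≤_; z≤n; s≤s)
open import Data.Nat.Properties
  using (≤-refl; ≤-trans; ≤-antisym; ≤-reflexive; <-irrefl; n<1+n; m+n≮n;
         +-comm; +-cancelʳ-≤; module ≤-Reasoning)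
open import Data.Product using (∃-syntax; _×_; _,_; proj₂)
open import Data.Sum using (_⊎_; inj₁; inj₂; [_,_]; swap)
open import Data.Empty using (⊥-elim)
open import Relation.Nullary using (¬_)
open import Relation.Binary.PropositionalEquality
  using (_≡_; _≢_; refl; sym; subst)

positive-summand : ∀ {s t} → 1 ≤ s → s + t ≢ t
positive-summand {suc s} {t} _ eq = m+n≮n s t (≤-reflexive eq)

pred-≢ : ∀ {n} → 1 ≤ n → n ≢ n ∸ 1
pred-≢ {suc m} _ eq = <-irrefl (sym eq) (n<1+n m)

module Metric {c ℓ : Level} (Γ : Graph c ℓ) where
  open Graph Γ

  _++ʷ_ : ∀ {x y z k m} → Walk Γ x y k → Walk Γ y z m → Walk Γ x z (k + m)
  nil      ++ʷ v = v
  cons e u ++ʷ v = cons e (u ++ʷ v)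

  snoc : ∀ {x y z k} → Walk Γ x y k → Adj y z → Walk Γ x z (suc k)
  snoc nil        e = cons e nil
  snoc (cons e′ u) e = cons e′ (snoc u e)

  reverse : ∀ {x y k} → Walk Γ x y k → Walk Γ y x k
  reverse nil        = nil
  reverse (cons e u) = snoc (reverse u) (Adj-sym e)

  Dist-sym : ∀ {x y k} → Dist Γ x y k → Dist Γ y x k
  Dist-sym (u , shortest) = reverse u , λ m v → shortest m (reverse v)

  Dist-unique : ∀ {x y k m} → Dist Γ x y k → Dist Γ x y m → k ≡ m
  Dist-unique (u , shortest) (v , shortest′) =
    ≤-antisym (shortest _ v) (shortest′ _ u)

  triangle : ∀ {x y z k m j} →
    Dist Γ x y k → Dist Γ y z m → Dist Γ x z j → j ≤ k + m
  triangle (u , _) (v , _) (_ , shortest) = shortest _ (u ++ʷ v)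

  Dist-positive : ∀ {x y k} → x ≢ y → Dist Γ x y k → 1 ≤ k
  Dist-positive {k = zero}  x≢y (nil , _) = ⊥-elim (x≢y refl)
  Dist-positive {k = suc k} _   _         = s≤s z≤n

  common-neighbour : ∀ {p a b k} → a ≢ b →
    Dist Γ p a 1 → Dist Γ p b 1 → Dist Γ a b k → Dist Γ a b 1 ⊎ Dist Γ a b 2
  common-neighbour {k = zero} a≢b _ _ Dab with Dist-positive a≢b Dab
  ... | ()
  common-neighbour {k = 1} _ _ _ Dab = inj₁ Dab
  common-neighbour {k = 2} _ _ _ Dab = inj₂ Dab
  common-neighbour {k = suc (suc (suc k))} _ Dpa Dpb Dab
    with triangle (Dist-sym Dpa) Dpb Dab
  ... | s≤s (s≤s ())

  Dist-exists : ∀ {n} → A2 Γ n → ∀ x y → ∃[ k ] Dist Γ x y k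
  Dist-exists a2 x y with a2 x y
  ... | _ , _ , k , _ , Dxy , _ = k , Dxy

module Antipodal {c ℓ : Level} (Γ : Graph c ℓ) (n : ℕ) where
  open Graph Γ
  open Metric Γ

  Covers : Point → Point → Point → Set _
  Covers p u v = ∀ x → Dist Γ x p n → Dist Γ x u n ⊎ Dist Γ x v n

  covers-swap : ∀ {p u v} → Covers p u v → Covers p v u
  covers-swap covers x Dxp = swap (covers x Dxp)

  cover⇒adjacent : 1 ≤ n → A2 Γ n → A4 Γ n → ∀ {p u v} →
    p ≢ u → v ≢ p → Covers p u v → Dist Γ p u 1
  cover⇒adjacent n≥1 a2 a4 {p} {u} {v} p≢u v≢p covers
    with a2 p u
  ... | z , Dpz , s , t , Dpu , Duz , s+t≡n
    with covers z (Dist-sym Dpz)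
  ... | inj₁ Dzu =
    ⊥-elim (positive-summand s≥1
      (subst (s + t ≡_) (Dist-unique (Dist-sym Dzu) Duz) s+t≡n))
    where
    s≥1 : 1 ≤ s
    s≥1 = Dist-positive p≢u Dpu
  ... | inj₂ Dzv
    with a4 v p z v≢p (Dist-sym Dzv) Dpz
  ... | w , Dzw , Dvw , Dpw
    with covers w (Dist-sym Dpw)
  ... | inj₂ Dwv = ⊥-elim (pred-≢ n≥1 (Dist-unique (Dist-sym Dwv) Dvw))
  ... | inj₁ Dwu = subst (Dist Γ p u) s≡1 Dpu
    where
    -- n = s + t ≤ d(w,z) + d(z,u) = 1 + t, so s ≤ 1.
    s+t≤1+t : s + t ≤ 1 + t
    s+t≤1+t = subst (_≤ 1 + t) (sym s+t≡n)
                (triangle (Dist-sym Dzw) (Dist-sym Duz) Dwu)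

    s≡1 : s ≡ 1
    s≡1 = ≤-antisym (+-cancelʳ-≤ t s 1 s+t≤1+t) (Dist-positive p≢u Dpu)

  no-cover-at-distance-two : A2 Γ n → A3 Γ → ∀ {p a b} →
    Dist Γ p a 1 → Dist Γ p b 1 → Dist Γ a b 2 → ¬ Covers p a b
  no-cover-at-distance-two a2 a3 {p} {a} {b} Dpa Dpb Dab covers
    with a3 a b p (Dist-sym Dpa) (Dist-sym Dpb) Dab
  ... | w , Daw , Dbw , Dpw
    with a2 p w
  ... | z , Dpz , k₁ , k₂ , Dpw′ , Dwz , k₁+k₂≡n =
    [ too-close Daw , too-close Dbw ] (covers z (Dist-sym Dpz))
    where
    -- n = 2 + d(w,z), while neighbours of w are within 1 + d(w,z) of z.
    too-close : ∀ {y} → Dist Γ y w 1 → ¬ Dist Γ z y n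
    too-close Dyw Dzy = <-irrefl refl (begin-strict
      n       ≤⟨ triangle (Dist-sym Dwz) (Dist-sym Dyw) Dzy ⟩
      k₂ + 1  ≡⟨ +-comm k₂ 1 ⟩
      1 + k₂  <⟨ ≤-refl ⟩
      2 + k₂  ≡⟨ subst (λ j → j + k₂ ≡ n) (Dist-unique Dpw′ Dpw) k₁+k₂≡n ⟩
      n       ∎)
      where open ≤-Reasoning

lemma2p1 : ∀ {c ℓ : Level} (Γ : Graph c ℓ) (n : ℕ) →
    A1 Γ n → A2 Γ n → A3 Γ → A4 Γ n →
    (a b : Graph.Point Γ) → ¬ (a ≡ b) →
    (∃[ p ] (¬ (p ≡ a) × ¬ (p ≡ b) ×
    (∀ x → Dist Γ x p n → Dist Γ x a n ⊎ Dist Γ x b n))) →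
    Dist Γ a b 1
lemma2p1 Γ n (_ , diam-bound , _) a2 a3 a4 a b a≢b (p , p≢a , p≢b , covers) =
  [ id , (λ Dab₂ → ⊥-elim (no-cover-at-distance-two a2 a3 Dpa Dpb Dab₂ covers)) ]
    (common-neighbour a≢b Dpa Dpb (proj₂ (Dist-exists a2 a b)))
  where
  open Metric Γ
  open Antipodal Γ n

  -- a ≠ b gives 1 ≤ d(a,b) ≤ n.
  n≥1 : 1 ≤ n
  n≥1 = let k , Dab = Dist-exists a2 a b
        in ≤-trans (Dist-positive a≢b Dab) (diam-bound a b k Dab)

  Dpa : Dist Γ p a 1
  Dpa = cover⇒adjacent n≥1 a2 a4 p≢a (λ b≡p → p≢b (sym b≡p)) covers

  Dpb : Dist Γ p b 1
  Dpb = cover⇒adjacent n≥1 a2 a4 p≢b (λ a≡p → p≢a (sym a≡p)) (covers-swap covers)
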